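{- Let $c\ge 1$ and $n\ge 1$ be integers and let $a\in\{1,\dots,c\}$. Then $$\left|\Pi_n^{eq}\wr C_c(1^a2^a)\right|=B(n)(c-1)^n+\sum_{i=1}^n\sum_{j=0}^{n-i}\binom{n}{i}\binom{n-i}{j}B(n-i-j)(c-1)^{n-i}.$$
   Context: $\Pi_n\wr C_c$ denotes the set of colored set partitions of $[n]$: pairs consisting of a set partition of $[n]$ and an assignment of a color in $\{1,\dots,c\}$ to each element. A colored partition eq-contains $1^a2^a$ if there are elements $x<y$ lying in different blocks, both colored $a$; otherwise it eq-avoids $1^a2^a$. $\Pi_n^{eq}\wr C_c(1^a2^a)$ is the set of elements of $\Pi_n\wr C_c$ eq-avoiding $1^a2^a$. $B(m)$ is the $m$-th Bell number, $B(0)=1$. -}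

module Defs where

open import Data.Nat using (ℕ; zero; suc; _+_; _*_; _∸_; _^_; _<ᵇ_)
open import Data.Nat.Combinatorics using (_C_)
open import Data.Bool using (Bool; true; false; _∧_; _∨_; not)
open import Data.Fin using (Fin; toℕ; _≟_)
open import Data.Vec using (Vec; []; _∷_; lookup)
open import Data.List using (List; []; _∷_; map; concatMap; filterᵇ; length; upTo; allFin)
open import Data.Nat.ListAction using (sum)
open import Data.Bool.ListAction using (any)
open import Data.Product using (_×_; _,_; proj₁; proj₂)
open import Relation.Nullary.Decidable using (⌊_⌋)

stirling2 : ℕ → ℕ → ℕ
stirling2 zero    zero    = 1
stirling2 zero    (suc k) = 0
stirling2 (suc n) zero    = 0
stirling2 (suc n) (suc k) = suc k * stirling2 n (suc k) + stirling2 n k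

bell : ℕ → ℕ
bell m = sum (map (stirling2 m) (upTo (suc m)))

allVecs : (k n : ℕ) → List (Vec (Fin k) n)
allVecs k zero    = [] ∷ []
allVecs k (suc n) = concatMap (λ x → map (x ∷_) (allVecs k n)) (allFin k)

-- A set partition of [n] is encoded by its restricted growth string:
-- element i lies in block (label i), labels are assigned in order of first
-- appearance: label 0 = 0 and label i ≤ 1 + max (labels before i).
-- (This is the standard bijection between set partitions and RGS.)
isRGSFrom : ∀ {k n} → ℕ → Vec (Fin k) n → Bool
isRGSFrom m []       = true
isRGSFrom m (x ∷ xs) = (toℕ x <ᵇ suc m) ∧ isRGSFrom (Data.Nat._⊔_ m (suc (toℕ x))) xs

isSetPartition : ∀ {n} → Vec (Fin n) n → Bool
isSetPartition v = isRGSFrom 0 v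

-- colored set partition candidates: (block labels, colors)
Colored : ℕ → ℕ → Set
Colored n c = Vec (Fin n) n × Vec (Fin c) n

allPairs : ∀ {A B : Set} → List A → List B → List (A × B)
allPairs xs ys = concatMap (λ x → map (x ,_) ys) xs

_==_ : ∀ {k} → Fin k → Fin k → Bool
x == y = ⌊ x ≟ y ⌋

eqContains : ∀ {n c} → Fin c → Colored n c → Bool
eqContains {n} a (blk , col) =
  any (λ xy → let x = proj₁ xy ; y = proj₂ xy in
         (toℕ x <ᵇ toℕ y) ∧ not (lookup blk x == lookup blk y)
           ∧ (lookup col x == a) ∧ (lookup col y == a))
      (allPairs (allFin n) (allFin n))

countEqAvoid : (n c : ℕ) → Fin c → ℕ
countEqAvoid n c a =
  length (filterᵇ (λ p → isSetPartition (proj₁ p) ∧ not (eqContains a p))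
                  (allPairs (allVecs n n) (allVecs c n)))

rhs : ℕ → ℕ → ℕ
rhs n c = bell n * (c ∸ 1) ^ n
  + sum (map (λ i → sum (map (λ j → (n C i) * ((n ∸ i) C j) * bell (n ∸ i ∸ j) * (c ∸ 1) ^ (n ∸ i))
                             (upTo (suc (n ∸ i)))))
             (map suc (upTo n)))

-- A coloured partition eq-avoids 1^a2^a exactly when all its elements of colour a lie in one
-- block. Reading the partition as a restricted growth string from the left, the number of ways
-- to complete a prefix depends only on the number m of labels used so far and on whether the
-- block of colour a is already determined, which gives two linear recurrences. They are solved
-- explicitly by choosing the letters not coloured a: these form an arbitrary extension of the
-- growth string, while the letters coloured a join the determined block or, if there is none
-- yet, form together one more letter. For m = 0 the second solution is the stated formula,
-- whose inner sum is the Bell recurrence B(N + 1) = Σ_j C(N, j) B(N - j).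

module Submission where

open import Defs
open import Data.Nat
open import Data.Nat.Properties
open import Data.Nat.Combinatorics using (_C_; nCk+nC[k+1]≡[n+1]C[k+1]; k>n⇒nCk≡0; nCk≡nC[n∸k])
open import Data.Nat.ListAction using (sum)
open import Data.Nat.ListAction.Properties using (sum-++)
open import Data.Nat.Tactic.RingSolver using (solve-∀)
open import Algebra.Properties.CommutativeSemigroup +-commutativeSemigroup using (interchange)
open import Data.Bool using (Bool; true; false; _∧_; not; if_then_else_; T)
open import Data.Bool.Properties using (T-≡; ∧-zeroʳ)
open import Data.Empty using (⊥-elim)
open import Data.List using (List; []; _∷_; _++_; map; upTo; applyUpTo; concatMap; filterᵇ; length; tabulate; allFin; cartesianProduct)
open import Data.List.Properties using (map-∘; map-++; map-cong; tabulate-cong; map-tabulate)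
open import Data.List.Membership.Propositional using (_∈_; lose)
open import Data.List.Membership.Propositional.Properties using (∈-allFin; ∈-cartesianProduct⁺)
open import Data.List.Relation.Unary.Any using (satisfied)
open import Data.List.Relation.Unary.Any.Properties using (any⁺; any⁻)
open import Data.Fin using (Fin; zero; suc; toℕ) renaming (_≟_ to _≟ᶠ_)
open import Data.Fin.Properties using (toℕ-injective) renaming (suc-injective to Fin-suc-injective)
open import Data.Vec using (Vec; []; _∷_; lookup)
open import Data.Maybe using (Maybe; just; nothing)
open import Data.Product using (_×_; _,_; proj₁; ∃-syntax)
open import Function using (_∘_; id)
open import Function.Bundles using (module Equivalence)
open import Relation.Nullary using (¬_; yes; no; contradiction)
open import Relation.Nullary.Decidable using (⌊_⌋)
open import Relation.Binary.Definitions using (tri<; tri≈; tri>)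
open import Relation.Binary.PropositionalEquality
open ≡-Reasoning

-- Finite sums

∑< : ℕ → (ℕ → ℕ) → ℕ
∑< zero    f = 0
∑< (suc n) f = ∑< n f + f n

syntax ∑< n (λ i → t) = ∑[ i < n ] t

∑<-unfoldˡ : ∀ n f → ∑< (suc n) f ≡ f 0 + ∑< n (f ∘ suc)
∑<-unfoldˡ zero    f = +-comm 0 (f 0)
∑<-unfoldˡ (suc n) f = begin
  ∑< (suc n) f + f (suc n)          ≡⟨ cong (_+ f (suc n)) (∑<-unfoldˡ n f) ⟩
  f 0 + ∑< n (f ∘ suc) + f (suc n)  ≡⟨ +-assoc (f 0) _ _ ⟩
  f 0 + ∑< (suc n) (f ∘ suc)        ∎

∑<-cong-< : ∀ n {f g : ℕ → ℕ} → (∀ i → i < n → f i ≡ g i) → ∑< n f ≡ ∑< n g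
∑<-cong-< zero    f≡g = refl
∑<-cong-< (suc n) f≡g =
  cong₂ _+_ (∑<-cong-< n (λ i i<n → f≡g i (m<n⇒m<1+n i<n))) (f≡g n ≤-refl)

∑<-cong : ∀ n {f g : ℕ → ℕ} → (∀ i → f i ≡ g i) → ∑< n f ≡ ∑< n g
∑<-cong n f≡g = ∑<-cong-< n (λ i _ → f≡g i)

∑<-distrib-+ : ∀ n (f g : ℕ → ℕ) → ∑[ i < n ] (f i + g i) ≡ ∑< n f + ∑< n g
∑<-distrib-+ zero    f g = refl
∑<-distrib-+ (suc n) f g =
  trans (cong (_+ (f n + g n)) (∑<-distrib-+ n f g)) (interchange (∑< n f) (∑< n g) (f n) (g n))

∑<-distribˡ-* : ∀ n a (f : ℕ → ℕ) → ∑[ i < n ] (a * f i) ≡ a * ∑< n f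
∑<-distribˡ-* zero    a f = sym (*-zeroʳ a)
∑<-distribˡ-* (suc n) a f =
  trans (cong (_+ a * f n) (∑<-distribˡ-* n a f)) (sym (*-distribˡ-+ a (∑< n f) (f n)))

∑<-linear : ∀ n a (f g : ℕ → ℕ) → ∑[ i < n ] (a * f i + g i) ≡ a * ∑< n f + ∑< n g
∑<-linear n a f g =
  trans (∑<-distrib-+ n (λ i → a * f i) g) (cong (_+ ∑< n g) (∑<-distribˡ-* n a f))

∑<-const : ∀ n a → ∑[ i < n ] a ≡ n * a
∑<-const zero    a = refl
∑<-const (suc n) a = trans (cong (_+ a) (∑<-const n a)) (+-comm (n * a) a)

∑<-reverse : ∀ N f → ∑< (suc N) f ≡ ∑[ i < suc N ] f (N ∸ i)
∑<-reverse zero    f = refl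
∑<-reverse (suc N) f = begin
  ∑< (suc (suc N)) f                                    ≡⟨ ∑<-unfoldˡ (suc N) f ⟩
  f 0 + ∑< (suc N) (f ∘ suc)                            ≡⟨ cong (f 0 +_) (∑<-reverse N (f ∘ suc)) ⟩
  f 0 + ∑[ i < suc N ] f (suc (N ∸ i))                  ≡⟨ cong (f 0 +_) (∑<-cong-< (suc N) suc-∸) ⟩
  f 0 + ∑[ i < suc N ] f (suc N ∸ i)                    ≡⟨ +-comm (f 0) _ ⟩
  ∑[ i < suc N ] f (suc N ∸ i) + f 0                    ≡⟨ cong (λ z → ∑[ i < suc N ] f (suc N ∸ i) + f z) (n∸n≡0 (suc N)) ⟨
  ∑[ i < suc (suc N) ] f (suc N ∸ i)                    ∎
  where
  suc-∸ : ∀ i → i < suc N → f (suc (N ∸ i)) ≡ f (suc N ∸ i)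
  suc-∸ i i<1+N = cong f (sym (+-∸-assoc 1 (≤-pred i<1+N)))

sum-map-applyUpTo : ∀ n (f g : ℕ → ℕ) → sum (map f (applyUpTo g n)) ≡ ∑[ i < n ] f (g i)
sum-map-applyUpTo zero    f g = refl
sum-map-applyUpTo (suc n) f g =
  trans (cong (f (g 0) +_) (sum-map-applyUpTo n f (g ∘ suc))) (sym (∑<-unfoldˡ n (f ∘ g)))

sum-map-upTo : ∀ n f → sum (map f (upTo n)) ≡ ∑< n f
sum-map-upTo n f = sum-map-applyUpTo n f id

∑<-pascal : ∀ r k (x : ℕ → ℕ) →
  ∑[ i < suc k ] ((suc r C i) * x i) ≡ ∑[ i < suc k ] ((r C i) * x i) + ∑[ i < k ] ((r C i) * x (suc i))
∑<-pascal r zero    x = sym (+-identityʳ _)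
∑<-pascal r (suc k) x = begin
    ∑[ i < suc k ] ((suc r C i) * x i) + (suc r C suc k) * x (suc k)
  ≡⟨ cong₂ _+_ (∑<-pascal r k x) (cong (_* x (suc k)) (sym (nCk+nC[k+1]≡[n+1]C[k+1] r k))) ⟩
    (A + B) + (r C k + r C suc k) * x (suc k)
  ≡⟨ regroup A B (r C k) (r C suc k) (x (suc k)) ⟩
    (A + (r C suc k) * x (suc k)) + (B + (r C k) * x (suc k))
  ∎
  where
  A = ∑[ i < suc k ] ((r C i) * x i)
  B = ∑[ i < k ] ((r C i) * x (suc i))
  regroup : ∀ a b p q y → (a + b) + (p + q) * y ≡ (a + q * y) + (b + p * y)
  regroup = solve-∀

∑<-C-overshoot : ∀ N (f : ℕ → ℕ) → ∑[ j < suc (suc N) ] ((N C j) * f j) ≡ ∑[ j < suc N ] ((N C j) * f j)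
∑<-C-overshoot N f =
  trans (cong (λ z → ∑[ j < suc N ] ((N C j) * f j) + z * f (suc N)) (k>n⇒nCk≡0 (n<1+n N)))
        (+-identityʳ _)

-- Bell numbers

-- extBell r m counts the ways to append r letters to a restricted growth string that
-- already uses m labels, and stirlingFrom r m k those after which it uses exactly k labels.
extBell : ℕ → ℕ → ℕ
extBell zero    m = 1
extBell (suc r) m = m * extBell r m + extBell r (suc m)

stirlingFrom : ℕ → ℕ → ℕ → ℕ
stirlingFrom zero    zero    zero    = 1
stirlingFrom zero    zero    (suc k) = 0
stirlingFrom zero    (suc m) zero    = 0
stirlingFrom zero    (suc m) (suc k) = stirlingFrom zero m k
stirlingFrom (suc r) m       k       = m * stirlingFrom r m k + stirlingFrom r (suc m) k

stirlingFrom-zero-* : ∀ m k → m * stirlingFrom zero m k ≡ k * stirlingFrom zero m k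
stirlingFrom-zero-* zero    zero    = refl
stirlingFrom-zero-* zero    (suc k) = sym (*-zeroʳ k)
stirlingFrom-zero-* (suc m) zero    = *-zeroʳ (suc m)
stirlingFrom-zero-* (suc m) (suc k) = cong (stirlingFrom zero m k +_) (stirlingFrom-zero-* m k)

stirlingFrom-suc-zero : ∀ r m → stirlingFrom (suc r) m zero ≡ 0
stirlingFrom-suc-zero zero    zero    = refl
stirlingFrom-suc-zero zero    (suc m) = cong (_+ 0) (*-zeroʳ (suc m))
stirlingFrom-suc-zero (suc r) m
  rewrite stirlingFrom-suc-zero r m | stirlingFrom-suc-zero r (suc m) = cong (_+ 0) (*-zeroʳ m)

stirlingFrom-suc-suc : ∀ r m k →
  stirlingFrom (suc r) m (suc k) ≡ suc k * stirlingFrom r m (suc k) + stirlingFrom r m k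
stirlingFrom-suc-suc zero m k = cong (_+ stirlingFrom zero (suc m) (suc k)) (stirlingFrom-zero-* m (suc k))
stirlingFrom-suc-suc (suc r) m k = begin
    m * stirlingFrom (suc r) m (suc k) + stirlingFrom (suc r) (suc m) (suc k)
  ≡⟨ cong₂ (λ u v → m * u + v) (stirlingFrom-suc-suc r m k) (stirlingFrom-suc-suc r (suc m) k) ⟩
    m * (suc k * a + b) + (suc k * c + e)
  ≡⟨ regroup m (suc k) a b c e ⟩
    suc k * (m * a + c) + (m * b + e)
  ∎
  where
  a = stirlingFrom r m (suc k)
  b = stirlingFrom r m k
  c = stirlingFrom r (suc m) (suc k)
  e = stirlingFrom r (suc m) k
  regroup : ∀ m k a b c e → m * (k * a + b) + (k * c + e) ≡ k * (m * a + c) + (m * b + e)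
  regroup = solve-∀

stirling2≡stirlingFrom : ∀ n k → stirling2 n k ≡ stirlingFrom n 0 k
stirling2≡stirlingFrom zero    zero    = refl
stirling2≡stirlingFrom zero    (suc k) = refl
stirling2≡stirlingFrom (suc n) zero    = sym (stirlingFrom-suc-zero n 0)
stirling2≡stirlingFrom (suc n) (suc k)
  rewrite stirling2≡stirlingFrom n (suc k) | stirling2≡stirlingFrom n k = sym (stirlingFrom-suc-suc n 0 k)

∑<-stirlingFrom-zero : ∀ m T → m < T → ∑< T (stirlingFrom zero m) ≡ 1
∑<-stirlingFrom-zero zero    (suc T) _ =
  trans (∑<-unfoldˡ T (stirlingFrom zero zero)) (cong suc (trans (∑<-const T 0) (*-zeroʳ T)))
∑<-stirlingFrom-zero (suc m) (suc T) (s≤s m<T) =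
  trans (∑<-unfoldˡ T (stirlingFrom zero (suc m))) (∑<-stirlingFrom-zero m T m<T)

∑<-stirlingFrom : ∀ r m T → m + r < T → ∑< T (stirlingFrom r m) ≡ extBell r m
∑<-stirlingFrom zero    m T m+0<T = ∑<-stirlingFrom-zero m T (subst (_< T) (+-identityʳ m) m+0<T)
∑<-stirlingFrom (suc r) m T m+1+r<T = begin
    ∑[ k < T ] (m * stirlingFrom r m k + stirlingFrom r (suc m) k)
  ≡⟨ ∑<-linear T m (stirlingFrom r m) (stirlingFrom r (suc m)) ⟩
    m * ∑< T (stirlingFrom r m) + ∑< T (stirlingFrom r (suc m))
  ≡⟨ cong₂ (λ u v → m * u + v) (∑<-stirlingFrom r m T m+r<T) (∑<-stirlingFrom r (suc m) T 1+m+r<T) ⟩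
    extBell (suc r) m
  ∎
  where
  1+m+r<T = subst (_< T) (+-suc m r) m+1+r<T
  m+r<T = <-trans (+-monoʳ-< m (n<1+n r)) m+1+r<T

bell≡extBell : ∀ N → bell N ≡ extBell N 0
bell≡extBell N = begin
  bell N                               ≡⟨ sum-map-upTo (suc N) (stirling2 N) ⟩
  ∑< (suc N) (stirling2 N)             ≡⟨ ∑<-cong (suc N) (stirling2≡stirlingFrom N) ⟩
  ∑< (suc N) (stirlingFrom N 0)        ≡⟨ ∑<-stirlingFrom N 0 (suc N) ≤-refl ⟩
  extBell N 0                          ∎

extBell-binomial : ∀ N m → ∑[ j < suc N ] ((N C j) * extBell j m) ≡ extBell N (suc m)
extBell-binomial zero    m = refl
extBell-binomial (suc N) m = begin
    ∑[ j < suc (suc N) ] ((suc N C j) * extBell j m)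
  ≡⟨ ∑<-pascal N (suc N) (λ j → extBell j m) ⟩
    ∑[ j < suc (suc N) ] ((N C j) * extBell j m) + ∑[ j < suc N ] ((N C j) * extBell (suc j) m)
  ≡⟨ cong₂ _+_ (trans (∑<-C-overshoot N (λ j → extBell j m)) (extBell-binomial N m))
               (∑<-cong (suc N) (λ j → spread (N C j) m (extBell j m) (extBell j (suc m)))) ⟩
    extBell N (suc m) + ∑[ j < suc N ] (m * ((N C j) * extBell j m) + (N C j) * extBell j (suc m))
  ≡⟨ cong (extBell N (suc m) +_) (∑<-linear (suc N) m _ _) ⟩
    extBell N (suc m) + (m * ∑[ j < suc N ] ((N C j) * extBell j m)
                         + ∑[ j < suc N ] ((N C j) * extBell j (suc m)))
  ≡⟨ cong₂ (λ u v → extBell N (suc m) + (m * u + v)) (extBell-binomial N m) (extBell-binomial N (suc m)) ⟩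
    extBell N (suc m) + (m * extBell N (suc m) + extBell N (suc (suc m)))
  ≡⟨ +-assoc (extBell N (suc m)) _ _ ⟨
    extBell (suc N) (suc m)
  ∎
  where
  spread : ∀ c m a b → c * (m * a + b) ≡ m * (c * a) + c * b
  spread = solve-∀

bell-suc : ∀ N → ∑[ j < suc N ] ((N C j) * bell (N ∸ j)) ≡ bell (suc N)
bell-suc N = begin
    ∑[ j < suc N ] ((N C j) * bell (N ∸ j))
  ≡⟨ ∑<-reverse N (λ j → (N C j) * bell (N ∸ j)) ⟩
    ∑[ j < suc N ] ((N C (N ∸ j)) * bell (N ∸ (N ∸ j)))
  ≡⟨ ∑<-cong-< (suc N) complement ⟩
    ∑[ j < suc N ] ((N C j) * extBell j 0)
  ≡⟨ extBell-binomial N 0 ⟩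
    extBell (suc N) 0
  ≡⟨ bell≡extBell (suc N) ⟨
    bell (suc N)
  ∎
  where
  complement : ∀ j → j < suc N → (N C (N ∸ j)) * bell (N ∸ (N ∸ j)) ≡ (N C j) * extBell j 0
  complement j j<1+N = cong₂ _*_ (sym (nCk≡nC[n∸k] j≤N)) (trans (cong bell (m∸[m∸n]≡n j≤N)) (bell≡extBell j))
    where j≤N = ≤-pred j<1+N

-- Closed forms for the coloured extensions by r letters: d is the number of colours other
-- than a, and i counts the appended letters not coloured a. In freeExt the letters coloured a,
-- if there are any, act together as one extra letter.
pinnedExt : ℕ → ℕ → ℕ → ℕ
pinnedExt d r m = ∑[ i < suc r ] ((r C i) * (d ^ i * extBell i m))

freeExt : ℕ → ℕ → ℕ → ℕ
freeExt d r m = d ^ r * extBell r m + ∑[ i < r ] ((r C i) * (d ^ i * extBell (suc i) m))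

private
  spread : ∀ c p m a b → c * (p * (m * a + b)) ≡ m * (c * (p * a)) + c * (p * b)
  spread = solve-∀

  spread-d : ∀ c d p m a b → c * ((d * p) * (m * a + b)) ≡ d * (m * (c * (p * a)) + c * (p * b))
  spread-d = solve-∀

pinnedExt-suc : ∀ d r m → pinnedExt d (suc r) m ≡ d * (m * pinnedExt d r m + pinnedExt d r (suc m)) + pinnedExt d r m
pinnedExt-suc d r m = begin
    pinnedExt d (suc r) m
  ≡⟨ ∑<-pascal r (suc r) (λ i → d ^ i * extBell i m) ⟩
    ∑[ i < suc (suc r) ] ((r C i) * (d ^ i * extBell i m))
      + ∑[ i < suc r ] ((r C i) * (d ^ suc i * extBell (suc i) m))
  ≡⟨ cong₂ _+_ (∑<-C-overshoot r (λ i → d ^ i * extBell i m))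
               (∑<-cong (suc r) (λ i → spread-d (r C i) d (d ^ i) m (extBell i m) (extBell i (suc m)))) ⟩
    pinnedExt d r m + ∑[ i < suc r ] (d * (m * ((r C i) * (d ^ i * extBell i m))
                                          + (r C i) * (d ^ i * extBell i (suc m))))
  ≡⟨ cong (pinnedExt d r m +_) (trans (∑<-distribˡ-* (suc r) d _) (cong (d *_) (∑<-linear (suc r) m _ _))) ⟩
    pinnedExt d r m + d * (m * pinnedExt d r m + pinnedExt d r (suc m))
  ≡⟨ +-comm (pinnedExt d r m) _ ⟩
    d * (m * pinnedExt d r m + pinnedExt d r (suc m)) + pinnedExt d r m
  ∎

freeExt-suc : ∀ d r m →
  freeExt d (suc r) m ≡ d * (m * freeExt d r m + freeExt d r (suc m)) + (m * pinnedExt d r m + pinnedExt d r (suc m))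
freeExt-suc d r m = begin
    freeExt d (suc r) m
  ≡⟨ cong (d ^ suc r * extBell (suc r) m +_) (∑<-pascal r r (λ i → d ^ i * extBell (suc i) m)) ⟩
    d ^ suc r * extBell (suc r) m + (∑[ i < suc r ] ((r C i) * (d ^ i * extBell (suc i) m)) + ∑[ i < r ] ((r C i) * (d ^ suc i * extBell (suc (suc i)) m)))
  ≡⟨ cong (d ^ suc r * extBell (suc r) m +_) (cong₂ _+_
       (trans (∑<-cong (suc r) (λ i → spread (r C i) (d ^ i) m (extBell i m) (extBell i (suc m))))
              (∑<-linear (suc r) m _ _))
       (trans (∑<-cong r (λ i → spread-d (r C i) d (d ^ i) m (extBell (suc i) m) (extBell (suc i) (suc m))))
              (trans (∑<-distribˡ-* r d _) (cong (d *_) (∑<-linear r m _ _))))) ⟩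
    d ^ suc r * extBell (suc r) m + ((m * pinnedExt d r m + pinnedExt d r (suc m)) + d * (m * S + S′))
  ≡⟨ regroup d (d ^ r) m (extBell r m) (extBell r (suc m)) S S′ (pinnedExt d r m) (pinnedExt d r (suc m)) ⟩
    d * (m * freeExt d r m + freeExt d r (suc m)) + (m * pinnedExt d r m + pinnedExt d r (suc m))
  ∎
  where
  S  = ∑[ i < r ] ((r C i) * (d ^ i * extBell (suc i) m))
  S′ = ∑[ i < r ] ((r C i) * (d ^ i * extBell (suc i) (suc m)))
  regroup : ∀ d p m a b s s′ g g′ →
    (d * p) * (m * a + b) + ((m * g + g′) + d * (m * s + s′)) ≡ d * (m * (p * a + s) + (p * b + s′)) + (m * g + g′)
  regroup = solve-∀

private
  inner-sum : ∀ d n i →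
    sum (map (λ j → (n C i) * ((n ∸ i) C j) * bell (n ∸ i ∸ j) * d ^ (n ∸ i)) (upTo (suc (n ∸ i))))
      ≡ ((n C i) * d ^ (n ∸ i)) * bell (suc (n ∸ i))
  inner-sum d n i = begin
      sum (map (λ j → (n C i) * ((n ∸ i) C j) * bell (n ∸ i ∸ j) * d ^ (n ∸ i)) (upTo (suc (n ∸ i))))
    ≡⟨ sum-map-upTo (suc (n ∸ i)) _ ⟩
      ∑[ j < suc (n ∸ i) ] ((n C i) * ((n ∸ i) C j) * bell (n ∸ i ∸ j) * d ^ (n ∸ i))
    ≡⟨ ∑<-cong (suc (n ∸ i)) (λ j → factor (n C i) ((n ∸ i) C j) (bell (n ∸ i ∸ j)) (d ^ (n ∸ i))) ⟩
      ∑[ j < suc (n ∸ i) ] (((n C i) * d ^ (n ∸ i)) * (((n ∸ i) C j) * bell (n ∸ i ∸ j)))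
    ≡⟨ ∑<-distribˡ-* (suc (n ∸ i)) ((n C i) * d ^ (n ∸ i)) _ ⟩
      ((n C i) * d ^ (n ∸ i)) * ∑[ j < suc (n ∸ i) ] (((n ∸ i) C j) * bell (n ∸ i ∸ j))
    ≡⟨ cong (((n C i) * d ^ (n ∸ i)) *_) (bell-suc (n ∸ i)) ⟩
      ((n C i) * d ^ (n ∸ i)) * bell (suc (n ∸ i))
    ∎
    where
    factor : ∀ a b c e → a * b * c * e ≡ (a * e) * (b * c)
    factor = solve-∀

rhs≡freeExt : ∀ d n → rhs n (suc d) ≡ freeExt d n 0
rhs≡freeExt d zero    = refl
rhs≡freeExt d (suc p) = cong₂ _+_
  (trans (cong (_* d ^ n) (bell≡extBell n)) (*-comm (extBell n 0) (d ^ n)))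
  (begin
      sum (map outer (map suc (upTo n)))
    ≡⟨ cong sum (map-∘ (upTo n)) ⟨
      sum (map (outer ∘ suc) (upTo n))
    ≡⟨ sum-map-upTo n (outer ∘ suc) ⟩
      ∑[ i < n ] outer (suc i)
    ≡⟨ ∑<-cong n (λ i → inner-sum d n (suc i)) ⟩
      ∑[ i < suc p ] (((n C suc i) * d ^ (p ∸ i)) * bell (suc (p ∸ i)))
    ≡⟨ ∑<-reverse p _ ⟩
      ∑[ i < suc p ] (((n C suc (p ∸ i)) * d ^ (p ∸ (p ∸ i))) * bell (suc (p ∸ (p ∸ i))))
    ≡⟨ ∑<-cong-< n complement ⟩
      ∑[ i < suc p ] ((n C i) * (d ^ i * extBell (suc i) 0))
    ∎)
  where
  n = suc p
  outer : ℕ → ℕ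
  outer i = sum (map (λ j → (n C i) * ((n ∸ i) C j) * bell (n ∸ i ∸ j) * d ^ (n ∸ i)) (upTo (suc (n ∸ i))))
  complement : ∀ i → i < n →
    ((n C suc (p ∸ i)) * d ^ (p ∸ (p ∸ i))) * bell (suc (p ∸ (p ∸ i))) ≡ (n C i) * (d ^ i * extBell (suc i) 0)
  complement i i<n = begin
      ((n C suc (p ∸ i)) * d ^ (p ∸ (p ∸ i))) * bell (suc (p ∸ (p ∸ i)))
    ≡⟨ cong₂ (λ u v → ((n C u) * d ^ v) * bell (suc v)) (sym (+-∸-assoc 1 i≤p)) (m∸[m∸n]≡n i≤p) ⟩
      ((n C (n ∸ i)) * d ^ i) * bell (suc i)
    ≡⟨ cong₂ (λ u v → (u * d ^ i) * v) (sym (nCk≡nC[n∸k] (m≤n⇒m≤1+n i≤p))) (bell≡extBell (suc i)) ⟩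
      ((n C i) * d ^ i) * extBell (suc i) 0
    ≡⟨ *-assoc (n C i) (d ^ i) _ ⟩
      (n C i) * (d ^ i * extBell (suc i) 0)
    ∎
    where i≤p = ≤-pred i<n

-- Counting colourings

𝟙 : Bool → ℕ
𝟙 true  = 1
𝟙 false = 0

length-filterᵇ : ∀ {A : Set} (p : A → Bool) xs → length (filterᵇ p xs) ≡ sum (map (𝟙 ∘ p) xs)
length-filterᵇ p []       = refl
length-filterᵇ p (x ∷ xs) with p x
... | true  = cong suc (length-filterᵇ p xs)
... | false = length-filterᵇ p xs

sum-map-cong : ∀ {A : Set} {f g : A → ℕ} xs → (∀ x → f x ≡ g x) → sum (map f xs) ≡ sum (map g xs)
sum-map-cong xs f≗g = cong sum (map-cong f≗g xs)

sum-map-zero : ∀ {A : Set} (xs : List A) → sum (map (λ _ → 0) xs) ≡ 0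
sum-map-zero []       = refl
sum-map-zero (x ∷ xs) = sum-map-zero xs

sum-map-concatMap : ∀ {A B : Set} (f : B → ℕ) (g : A → List B) xs →
  sum (map f (concatMap g xs)) ≡ sum (map (λ x → sum (map f (g x))) xs)
sum-map-concatMap f g []       = refl
sum-map-concatMap f g (x ∷ xs) = begin
  sum (map f (g x ++ concatMap g xs))             ≡⟨ cong sum (map-++ f (g x) _) ⟩
  sum (map f (g x) ++ map f (concatMap g xs))     ≡⟨ sum-++ (map f (g x)) _ ⟩
  sum (map f (g x)) + sum (map f (concatMap g xs)) ≡⟨ cong (sum (map f (g x)) +_) (sum-map-concatMap f g xs) ⟩
  sum (map (λ x → sum (map f (g x))) (x ∷ xs))    ∎

∑Fin : ∀ k → (Fin k → ℕ) → ℕ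
∑Fin k f = sum (tabulate f)

∑Fin-cong : ∀ k {f g : Fin k → ℕ} → (∀ x → f x ≡ g x) → ∑Fin k f ≡ ∑Fin k g
∑Fin-cong k f≗g = cong sum (tabulate-cong f≗g)

∑Fin-distrib-+ : ∀ k (f g : Fin k → ℕ) → ∑Fin k (λ x → f x + g x) ≡ ∑Fin k f + ∑Fin k g
∑Fin-distrib-+ zero    f g = refl
∑Fin-distrib-+ (suc k) f g =
  trans (cong (f zero + g zero +_) (∑Fin-distrib-+ k (f ∘ suc) (g ∘ suc)))
        (interchange (f zero) (g zero) (∑Fin k (f ∘ suc)) (∑Fin k (g ∘ suc)))

∑Fin-const : ∀ k a → ∑Fin k (λ _ → a) ≡ k * a
∑Fin-const zero    a = refl
∑Fin-const (suc k) a = cong (a +_) (∑Fin-const k a)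

∑Fin-zero : ∀ k → ∑Fin k (λ _ → 0) ≡ 0
∑Fin-zero k = trans (∑Fin-const k 0) (*-zeroʳ k)

sum-map-allFin : ∀ k (f : Fin k → ℕ) → sum (map f (allFin k)) ≡ ∑Fin k f
sum-map-allFin k f = cong sum (map-tabulate id f)

sum-map-∑Fin : ∀ {A : Set} (xs : List A) k (f : A → Fin k → ℕ) →
  sum (map (λ x → ∑Fin k (f x)) xs) ≡ ∑Fin k (λ y → sum (map (λ x → f x y) xs))
sum-map-∑Fin []       k f = sym (∑Fin-zero k)
sum-map-∑Fin (x ∷ xs) k f =
  trans (cong (∑Fin k (f x) +_) (sum-map-∑Fin xs k f)) (sym (∑Fin-distrib-+ k (f x) _))

∑Fin-point : ∀ d (a : Fin (suc d)) (f : Fin (suc d) → ℕ) {u v} →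
  (∀ y → y ≡ a → f y ≡ u) → (∀ y → y ≢ a → f y ≡ v) → ∑Fin (suc d) f ≡ u + d * v
∑Fin-point d zero f {u} {v} at-a off-a =
  cong₂ _+_ (at-a zero refl) (trans (∑Fin-cong d (λ y → off-a (suc y) (λ ()))) (∑Fin-const d v))
∑Fin-point (suc d) (suc a) f {u} {v} at-a off-a = begin
    f zero + ∑Fin (suc d) (f ∘ suc)
  ≡⟨ cong₂ _+_ (off-a zero (λ ()))
       (∑Fin-point d a (f ∘ suc) (λ y y≡a → at-a (suc y) (cong suc y≡a))
                                 (λ y y≢a → off-a (suc y) (y≢a ∘ Fin-suc-injective))) ⟩
    v + (u + d * v)
  ≡⟨ +-comm v _ ⟩
    u + d * v + v
  ≡⟨ +-assoc u (d * v) v ⟩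
    u + (d * v + v)
  ≡⟨ cong (u +_) (+-comm (d * v) v) ⟩
    u + suc d * v
  ∎

∑Fin-below : ∀ k t (f : Fin k → ℕ) (g : ℕ → ℕ) → t ≤ k → (∀ x → toℕ x < t → f x ≡ g (toℕ x)) →
  ∑Fin k (λ x → if toℕ x <ᵇ t then f x else 0) ≡ ∑< t g
∑Fin-below k zero f g _ _ = ∑Fin-zero k
∑Fin-below (suc k) (suc t) f g (s≤s t≤k) f≗g = begin
    f zero + ∑Fin k (λ x → if toℕ x <ᵇ t then f (suc x) else 0)
  ≡⟨ cong₂ _+_ (f≗g zero z<s) (∑Fin-below k t (f ∘ suc) (g ∘ suc) t≤k (λ x x<t → f≗g (suc x) (s<s x<t))) ⟩
    g 0 + ∑< t (g ∘ suc)
  ≡⟨ ∑<-unfoldˡ t g ⟨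
    ∑< (suc t) g
  ∎

∑Vec : ∀ k r → (Vec (Fin k) r → ℕ) → ℕ
∑Vec k r f = sum (map f (allVecs k r))

∑Vec-suc : ∀ k r f → ∑Vec k (suc r) f ≡ ∑Fin k (λ x → ∑Vec k r (f ∘ (x ∷_)))
∑Vec-suc k r f = begin
    sum (map f (concatMap (λ x → map (x ∷_) (allVecs k r)) (allFin k)))
  ≡⟨ sum-map-concatMap f (λ x → map (x ∷_) (allVecs k r)) (allFin k) ⟩
    sum (map (λ x → sum (map f (map (x ∷_) (allVecs k r)))) (allFin k))
  ≡⟨ sum-map-cong (allFin k) (λ x → cong sum (map-∘ (allVecs k r))) ⟨
    sum (map (λ x → ∑Vec k r (f ∘ (x ∷_))) (allFin k))
  ≡⟨ sum-map-allFin k _ ⟩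
    ∑Fin k (λ x → ∑Vec k r (f ∘ (x ∷_)))
  ∎

∑Vec² : ∀ k c r → (Vec (Fin k) r → Vec (Fin c) r → ℕ) → ℕ
∑Vec² k c r f = ∑Vec k r (λ xs → ∑Vec c r (f xs))

∑Vec²-cong : ∀ k c r {f g : Vec (Fin k) r → Vec (Fin c) r → ℕ} →
  (∀ xs ys → f xs ys ≡ g xs ys) → ∑Vec² k c r f ≡ ∑Vec² k c r g
∑Vec²-cong k c r f≗g = sum-map-cong (allVecs k r) (λ xs → sum-map-cong (allVecs c r) (f≗g xs))

∑Vec²-zero : ∀ k c r → ∑Vec² k c r (λ _ _ → 0) ≡ 0
∑Vec²-zero k c r = trans (sum-map-cong (allVecs k r) (λ _ → sum-map-zero (allVecs c r))) (sum-map-zero (allVecs k r))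

∑Vec²-suc : ∀ k c r f →
  ∑Vec² k c (suc r) f ≡ ∑Fin k (λ x → ∑Fin c (λ y → ∑Vec² k c r (λ xs ys → f (x ∷ xs) (y ∷ ys))))
∑Vec²-suc k c r f = begin
    ∑Vec k (suc r) (λ xs → ∑Vec c (suc r) (f xs))
  ≡⟨ ∑Vec-suc k r _ ⟩
    ∑Fin k (λ x → ∑Vec k r (λ xs → ∑Vec c (suc r) (f (x ∷ xs))))
  ≡⟨ ∑Fin-cong k (λ x → sum-map-cong (allVecs k r) (λ xs → ∑Vec-suc c r (f (x ∷ xs)))) ⟩
    ∑Fin k (λ x → ∑Vec k r (λ xs → ∑Fin c (λ y → ∑Vec c r (λ ys → f (x ∷ xs) (y ∷ ys)))))
  ≡⟨ ∑Fin-cong k (λ x → sum-map-∑Fin (allVecs k r) c (λ xs y → ∑Vec c r (λ ys → f (x ∷ xs) (y ∷ ys)))) ⟩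
    ∑Fin k (λ x → ∑Fin c (λ y → ∑Vec² k c r (λ xs ys → f (x ∷ xs) (y ∷ ys))))
  ∎

∑<-indicator : ∀ m b u → b < m → ∑[ i < m ] (if ⌊ i ≟ b ⌋ then u else 0) ≡ u
∑<-indicator (suc m) b u b<1+m with m ≟ b
... | yes refl = cong (_+ u) (∑<-vanishes m ≤-refl)
  where
  ∑<-vanishes : ∀ j → j ≤ m → ∑[ i < j ] (if ⌊ i ≟ m ⌋ then u else 0) ≡ 0
  ∑<-vanishes zero    _     = refl
  ∑<-vanishes (suc j) 1+j≤m with j ≟ m
  ... | yes refl = contradiction 1+j≤m (<-irrefl refl)
  ... | no  _    = trans (+-identityʳ _) (∑<-vanishes j (<⇒≤ 1+j≤m))
... | no  m≢b = trans (+-identityʳ _) (∑<-indicator m b u (≤∧≢⇒< (≤-pred b<1+m) (m≢b ∘ sym)))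

∑<-suc-⊔ : ∀ m (f : ℕ → ℕ → ℕ) → ∑[ i < suc m ] f (m ⊔ suc i) i ≡ ∑[ i < m ] f m i + f (suc m) m
∑<-suc-⊔ m f = cong₂ _+_ (∑<-cong-< m (λ i i<m → cong (λ z → f z i) (m≥n⇒m⊔n≡m i<m)))
                         (cong (λ z → f z m) (m≤n⇒m⊔n≡n (n≤1+n m)))

fitsBlock : ∀ {k} → Maybe (Fin k) → Fin k → Bool
fitsBlock nothing  x = true
fitsBlock (just b) x = ⌊ toℕ x ≟ toℕ b ⌋

allPairs≡cartesianProduct : ∀ {A B : Set} (xs : List A) (ys : List B) → allPairs xs ys ≡ cartesianProduct xs ys
allPairs≡cartesianProduct []       ys = refl
allPairs≡cartesianProduct (x ∷ xs) ys = cong (map (x ,_) ys ++_) (allPairs≡cartesianProduct xs ys)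

module _ {c : ℕ} (a : Fin c) where

  -- s = just b records that the letters coloured a read so far lie in block b.
  colourInOneBlock : ∀ {k r} → Maybe (Fin k) → Vec (Fin k) r → Vec (Fin c) r → Bool
  colourInOneBlock s []       []       = true
  colourInOneBlock s (x ∷ xs) (y ∷ ys) =
    if y == a then fitsBlock s x ∧ colourInOneBlock (just x) xs ys else colourInOneBlock s xs ys

  ColourSplit : ∀ {k r} → Vec (Fin k) r → Vec (Fin c) r → Set
  ColourSplit xs ys = ∃[ i ] ∃[ j ] (lookup ys i ≡ a × lookup ys j ≡ a × lookup xs i ≢ lookup xs j)

  ColourLeaves : ∀ {k r} → Fin k → Vec (Fin k) r → Vec (Fin c) r → Set
  ColourLeaves b xs ys = ∃[ i ] (lookup ys i ≡ a × lookup xs i ≢ b)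

  colourInOneBlock⇒inBlock : ∀ {k r} (b : Fin k) (xs : Vec (Fin k) r) ys →
    T (colourInOneBlock (just b) xs ys) → ∀ i → lookup ys i ≡ a → lookup xs i ≡ b
  colourInOneBlock⇒inBlock b (x ∷ xs) (y ∷ ys) t i yᵢ≡a with y ≟ᶠ a | toℕ x ≟ toℕ b
  colourInOneBlock⇒inBlock b (x ∷ xs) (y ∷ ys) t zero    _    | yes _   | yes x≡b = toℕ-injective x≡b
  colourInOneBlock⇒inBlock b (x ∷ xs) (y ∷ ys) t (suc i) yᵢ≡a | yes _   | yes x≡b =
    trans (colourInOneBlock⇒inBlock x xs ys t i yᵢ≡a) (toℕ-injective x≡b)
  colourInOneBlock⇒inBlock b (x ∷ xs) (y ∷ ys) t i       _    | yes _   | no _    = ⊥-elim t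
  colourInOneBlock⇒inBlock b (x ∷ xs) (y ∷ ys) t zero    y≡a  | no y≢a | _       = contradiction y≡a y≢a
  colourInOneBlock⇒inBlock b (x ∷ xs) (y ∷ ys) t (suc i) yᵢ≡a | no _   | _       =
    colourInOneBlock⇒inBlock b xs ys t i yᵢ≡a

  colourInOneBlock⇒sameLabel : ∀ {k r} (xs : Vec (Fin k) r) ys → T (colourInOneBlock nothing xs ys) →
    ∀ i j → lookup ys i ≡ a → lookup ys j ≡ a → lookup xs i ≡ lookup xs j
  colourInOneBlock⇒sameLabel (x ∷ xs) (y ∷ ys) t i j yᵢ≡a yⱼ≡a with y ≟ᶠ a
  ... | yes _ = trans (labelIsHead i yᵢ≡a) (sym (labelIsHead j yⱼ≡a))
    where
    labelIsHead : ∀ i → lookup (y ∷ ys) i ≡ a → lookup (x ∷ xs) i ≡ x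
    labelIsHead zero    _     = refl
    labelIsHead (suc i) yᵢ≡a = colourInOneBlock⇒inBlock x xs ys t i yᵢ≡a
  colourInOneBlock⇒sameLabel (x ∷ xs) (y ∷ ys) t zero    j       y≡a  _    | no y≢a = contradiction y≡a y≢a
  colourInOneBlock⇒sameLabel (x ∷ xs) (y ∷ ys) t (suc i) zero    _    y≡a  | no y≢a = contradiction y≡a y≢a
  colourInOneBlock⇒sameLabel (x ∷ xs) (y ∷ ys) t (suc i) (suc j) yᵢ≡a yⱼ≡a | no _ =
    colourInOneBlock⇒sameLabel xs ys t i j yᵢ≡a yⱼ≡a

  ¬colourInOneBlock⇒leaves : ∀ {k r} (b : Fin k) (xs : Vec (Fin k) r) ys →
    ¬ T (colourInOneBlock (just b) xs ys) → ColourLeaves b xs ys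
  ¬colourInOneBlock⇒leaves b []       []       ¬t = contradiction _ ¬t
  ¬colourInOneBlock⇒leaves b (x ∷ xs) (y ∷ ys) ¬t with y ≟ᶠ a
  ... | no _ = let (i , yᵢ≡a , xᵢ≢b) = ¬colourInOneBlock⇒leaves b xs ys ¬t in suc i , yᵢ≡a , xᵢ≢b
  ... | yes y≡a with toℕ x ≟ toℕ b
  ...   | no x≢b  = zero , y≡a , x≢b ∘ cong toℕ
  ...   | yes x≡b = let (i , yᵢ≡a , xᵢ≢x) = ¬colourInOneBlock⇒leaves x xs ys ¬t
                    in suc i , yᵢ≡a , λ xᵢ≡b → xᵢ≢x (trans xᵢ≡b (sym (toℕ-injective x≡b)))

  ¬colourInOneBlock⇒split : ∀ {k r} (xs : Vec (Fin k) r) ys →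
    ¬ T (colourInOneBlock nothing xs ys) → ColourSplit xs ys
  ¬colourInOneBlock⇒split []       []       ¬t = contradiction _ ¬t
  ¬colourInOneBlock⇒split (x ∷ xs) (y ∷ ys) ¬t with y ≟ᶠ a
  ... | yes y≡a = let (i , yᵢ≡a , xᵢ≢x) = ¬colourInOneBlock⇒leaves x xs ys ¬t
                  in zero , suc i , y≡a , yᵢ≡a , xᵢ≢x ∘ sym
  ... | no _    = let (i , j , yᵢ≡a , yⱼ≡a , xᵢ≢xⱼ) = ¬colourInOneBlock⇒split xs ys ¬t
                  in suc i , suc j , yᵢ≡a , yⱼ≡a , xᵢ≢xⱼ

  splitsAt : ∀ {n} → Vec (Fin n) n → Vec (Fin c) n → Fin n → Fin n → Bool
  splitsAt blk col i j =
    (toℕ i <ᵇ toℕ j) ∧ not (lookup blk i == lookup blk j) ∧ (lookup col i == a) ∧ (lookup col j == a)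

  splitsAt⇒split : ∀ {n} (blk : Vec (Fin n) n) col i j → T (splitsAt blk col i j) → ColourSplit blk col
  splitsAt⇒split blk col i j t
    with toℕ i <ᵇ toℕ j | lookup blk i ≟ᶠ lookup blk j | lookup col i ≟ᶠ a | lookup col j ≟ᶠ a
  ... | true  | no blkᵢ≢blkⱼ | yes colᵢ≡a | yes colⱼ≡a = i , j , colᵢ≡a , colⱼ≡a , blkᵢ≢blkⱼ
  ... | false | _           | _          | _          = ⊥-elim t
  ... | true  | yes _       | _          | _          = ⊥-elim t
  ... | true  | no _        | no _       | _          = ⊥-elim t
  ... | true  | no _        | yes _      | no _       = ⊥-elim t

  split⇒splitsAt : ∀ {n} (blk : Vec (Fin n) n) col i j → toℕ i < toℕ j →
    lookup col i ≡ a → lookup col j ≡ a → lookup blk i ≢ lookup blk j → T (splitsAt blk col i j)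
  split⇒splitsAt blk col i j i<j colᵢ≡a colⱼ≡a blkᵢ≢blkⱼ
    with toℕ i <ᵇ toℕ j | <⇒<ᵇ i<j | lookup blk i ≟ᶠ lookup blk j | lookup col i ≟ᶠ a | lookup col j ≟ᶠ a
  ... | true | _ | no _         | yes _     | yes _     = _
  ... | true | _ | yes blkᵢ≡blkⱼ | _         | _         = contradiction blkᵢ≡blkⱼ blkᵢ≢blkⱼ
  ... | true | _ | no _         | no colᵢ≢a | _         = contradiction colᵢ≡a colᵢ≢a
  ... | true | _ | no _         | yes _     | no colⱼ≢a = contradiction colⱼ≡a colⱼ≢a

  eqContains⇒split : ∀ {n} (blk : Vec (Fin n) n) col → T (eqContains a (blk , col)) → ColourSplit blk col
  eqContains⇒split {n} blk col t =
    let ((i , j) , tᵢⱼ) = satisfied (any⁻ (λ (i , j) → splitsAt blk col i j) (allPairs (allFin n) (allFin n)) t)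
    in splitsAt⇒split blk col i j tᵢⱼ

  ordered-split⇒eqContains : ∀ {n} (blk : Vec (Fin n) n) col i j → toℕ i < toℕ j →
    lookup col i ≡ a → lookup col j ≡ a → lookup blk i ≢ lookup blk j → T (eqContains a (blk , col))
  ordered-split⇒eqContains {n} blk col i j i<j colᵢ≡a colⱼ≡a blkᵢ≢blkⱼ =
    any⁺ (λ (i , j) → splitsAt blk col i j) (lose ij∈pairs (split⇒splitsAt blk col i j i<j colᵢ≡a colⱼ≡a blkᵢ≢blkⱼ))
    where
    ij∈pairs : (i , j) ∈ allPairs (allFin n) (allFin n)
    ij∈pairs = subst ((i , j) ∈_) (sym (allPairs≡cartesianProduct (allFin n) (allFin n)))
                     (∈-cartesianProduct⁺ (∈-allFin i) (∈-allFin j))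

  split⇒eqContains : ∀ {n} (blk : Vec (Fin n) n) col → ColourSplit blk col → T (eqContains a (blk , col))
  split⇒eqContains blk col (i , j , colᵢ≡a , colⱼ≡a , blkᵢ≢blkⱼ) with <-cmp (toℕ i) (toℕ j)
  ... | tri< i<j _ _ = ordered-split⇒eqContains blk col i j i<j colᵢ≡a colⱼ≡a blkᵢ≢blkⱼ
  ... | tri≈ _ i≡j _ = contradiction (cong (lookup blk) (toℕ-injective i≡j)) blkᵢ≢blkⱼ
  ... | tri> _ _ j<i = ordered-split⇒eqContains blk col j i j<i colⱼ≡a colᵢ≡a (blkᵢ≢blkⱼ ∘ sym)

  not-eqContains≡colourInOneBlock : ∀ {n} (blk : Vec (Fin n) n) col →
    not (eqContains a (blk , col)) ≡ colourInOneBlock nothing blk col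
  not-eqContains≡colourInOneBlock blk col
    with eqContains a (blk , col) in contains | colourInOneBlock nothing blk col in oneBlock
  ... | false | true  = refl
  ... | true  | false = refl
  ... | true  | true  =
    let (i , j , colᵢ≡a , colⱼ≡a , blkᵢ≢blkⱼ) = eqContains⇒split blk col (Equivalence.from T-≡ contains)
    in contradiction (colourInOneBlock⇒sameLabel blk col (Equivalence.from T-≡ oneBlock) i j colᵢ≡a colⱼ≡a) blkᵢ≢blkⱼ
  ... | false | false =
    contradiction (split⇒eqContains blk col (¬colourInOneBlock⇒split blk col (subst T oneBlock)))
                  (subst T contains)

⊔-suc-+-≤ : ∀ {m r k i} → m + suc r ≤ k → i < suc m → m ⊔ suc i + r ≤ k
⊔-suc-+-≤ {m} {r} {k} m+1+r≤k i<1+m =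
  ≤-trans (+-monoˡ-≤ r (⊔-lub (n≤1+n m) i<1+m)) (subst (_≤ k) (+-suc m r) m+1+r≤k)

m+[1+n]≤o⇒m<o : ∀ {m n o} → m + suc n ≤ o → m < o
m+[1+n]≤o⇒m<o {m} {n} {o} m+1+n≤o = m+n≤o⇒m≤o (suc m) (subst (_≤ o) (+-suc m n) m+1+n≤o)

module _ (d : ℕ) (a : Fin (suc d)) where

  count : ∀ k r → ℕ → Maybe (Fin k) → ℕ
  count k r m s = ∑Vec² k (suc d) r (λ xs ys → 𝟙 (isRGSFrom m xs ∧ colourInOneBlock a s xs ys))

  -- Either the first letter x is coloured a, and its block becomes the block of colour a,
  -- or it has one of the other d colours.
  countAfter : ∀ k r → ℕ → Maybe (Fin k) → Fin k → ℕ
  countAfter k r m s x = (if fitsBlock s x then count k r m (just x) else 0) + d * count k r m s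

  count-suc : ∀ k r m (s : Maybe (Fin k)) →
    count k (suc r) m s ≡ ∑Fin k (λ x → if toℕ x <ᵇ suc m then countAfter k r (m ⊔ suc (toℕ x)) s x else 0)
  count-suc k r m s = trans (∑Vec²-suc k (suc d) r _) (∑Fin-cong k byFirstLetter)
    where
    byFirstLetter : ∀ x →
      ∑Fin (suc d) (λ y → ∑Vec² k (suc d) r (λ xs ys →
        𝟙 (((toℕ x <ᵇ suc m) ∧ isRGSFrom (m ⊔ suc (toℕ x)) xs) ∧ colourInOneBlock a s (x ∷ xs) (y ∷ ys))))
      ≡ (if toℕ x <ᵇ suc m then countAfter k r (m ⊔ suc (toℕ x)) s x else 0)
    byFirstLetter x with toℕ x <ᵇ suc m
    ... | false = trans (∑Fin-cong (suc d) (λ _ → ∑Vec²-zero k (suc d) r)) (∑Fin-zero (suc d))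
    ... | true  = ∑Fin-point d a _ colouredA colouredOther
      where
      m′ = m ⊔ suc (toℕ x)
      colouredA : ∀ y → y ≡ a →
        ∑Vec² k (suc d) r (λ xs ys → 𝟙 (isRGSFrom m′ xs ∧ colourInOneBlock a s (x ∷ xs) (y ∷ ys)))
        ≡ (if fitsBlock s x then count k r m′ (just x) else 0)
      colouredA y refl with a ≟ᶠ a | fitsBlock s x
      ... | no a≢a | _     = contradiction refl a≢a
      ... | yes _  | true  = refl
      ... | yes _  | false =
        trans (∑Vec²-cong k (suc d) r (λ xs _ → cong 𝟙 (∧-zeroʳ (isRGSFrom m′ xs)))) (∑Vec²-zero k (suc d) r)
      colouredOther : ∀ y → y ≢ a →
        ∑Vec² k (suc d) r (λ xs ys → 𝟙 (isRGSFrom m′ xs ∧ colourInOneBlock a s (x ∷ xs) (y ∷ ys)))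
        ≡ count k r m′ s
      colouredOther y y≢a with y ≟ᶠ a
      ... | yes y≡a = contradiction y≡a y≢a
      ... | no _    = refl

  count-pinned : ∀ k r m (b : Fin k) → m + r ≤ k → toℕ b < m → count k r m (just b) ≡ pinnedExt d r m
  count-pinned k zero    m b _         _   = refl
  count-pinned k (suc r) m b m+1+r≤k b<m = begin
      count k (suc r) m (just b)
    ≡⟨ count-suc k r m (just b) ⟩
      ∑Fin k (λ x → if toℕ x <ᵇ suc m then countAfter k r (m ⊔ suc (toℕ x)) (just b) x else 0)
    ≡⟨ ∑Fin-below k (suc m) _ (λ i → φ (m ⊔ suc i) i) (m+[1+n]≤o⇒m<o m+1+r≤k) byLabel ⟩
      ∑[ i < suc m ] φ (m ⊔ suc i) i
    ≡⟨ ∑<-suc-⊔ m φ ⟩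
      ∑[ i < m ] φ m i + φ (suc m) m
    ≡⟨ cong₂ _+_ (trans (∑<-distrib-+ m _ _) (cong₂ _+_ (∑<-indicator m (toℕ b) _ b<m) (∑<-const m _))) φ-last ⟩
      (P m + m * (d * P m)) + d * P (suc m)
    ≡⟨ regroup d m (P m) (P (suc m)) ⟩
      d * (m * P m + P (suc m)) + P m
    ≡⟨ pinnedExt-suc d r m ⟨
      pinnedExt d (suc r) m
    ∎
    where
    P = pinnedExt d r
    φ : ℕ → ℕ → ℕ
    φ m′ i = (if ⌊ i ≟ toℕ b ⌋ then P m′ else 0) + d * P m′
    byLabel : ∀ x → toℕ x < suc m → countAfter k r (m ⊔ suc (toℕ x)) (just b) x ≡ φ (m ⊔ suc (toℕ x)) (toℕ x)
    byLabel x x<1+m = cong₂ (λ u v → (if ⌊ toℕ x ≟ toℕ b ⌋ then u else 0) + d * v)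
      (count-pinned k r _ x bound (m≤n⊔m m (suc (toℕ x))))
      (count-pinned k r _ b bound (<-≤-trans b<m (m≤m⊔n m (suc (toℕ x)))))
      where bound = ⊔-suc-+-≤ m+1+r≤k x<1+m
    φ-last : φ (suc m) m ≡ d * P (suc m)
    φ-last with m ≟ toℕ b
    ... | yes m≡b = contradiction (subst (_< m) (sym m≡b) b<m) (<-irrefl refl)
    ... | no _    = refl
    regroup : ∀ d m p p′ → (p + m * (d * p)) + d * p′ ≡ d * (m * p + p′) + p
    regroup = solve-∀

  count-free : ∀ k r m → m + r ≤ k → count k r m nothing ≡ freeExt d r m
  count-free k zero    m _         = refl
  count-free k (suc r) m m+1+r≤k = begin
      count k (suc r) m nothing
    ≡⟨ count-suc k r m nothing ⟩
      ∑Fin k (λ x → if toℕ x <ᵇ suc m then countAfter k r (m ⊔ suc (toℕ x)) nothing x else 0)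
    ≡⟨ ∑Fin-below k (suc m) _ (λ i → ψ (m ⊔ suc i)) (m+[1+n]≤o⇒m<o m+1+r≤k) byLabel ⟩
      ∑[ i < suc m ] ψ (m ⊔ suc i)
    ≡⟨ ∑<-suc-⊔ m (λ m′ _ → ψ m′) ⟩
      ∑[ i < m ] ψ m + ψ (suc m)
    ≡⟨ cong (_+ ψ (suc m)) (∑<-const m (ψ m)) ⟩
      m * ψ m + ψ (suc m)
    ≡⟨ regroup d m (P r m) (P r (suc m)) (F r m) (F r (suc m)) ⟩
      d * (m * F r m + F r (suc m)) + (m * P r m + P r (suc m))
    ≡⟨ freeExt-suc d r m ⟨
      F (suc r) m
    ∎
    where
    P = pinnedExt d
    F = freeExt d
    ψ : ℕ → ℕ
    ψ m′ = P r m′ + d * F r m′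
    byLabel : ∀ x → toℕ x < suc m → countAfter k r (m ⊔ suc (toℕ x)) nothing x ≡ ψ (m ⊔ suc (toℕ x))
    byLabel x x<1+m = cong₂ (λ u v → u + d * v)
      (count-pinned k r _ x bound (m≤n⊔m m (suc (toℕ x))))
      (count-free k r _ bound)
      where bound = ⊔-suc-+-≤ m+1+r≤k x<1+m
    regroup : ∀ d m p p′ f f′ → m * (p + d * f) + (p′ + d * f′) ≡ d * (m * f + f′) + (m * p + p′)
    regroup = solve-∀

  countEqAvoid≡count : ∀ n → countEqAvoid n (suc d) a ≡ count n n 0 nothing
  countEqAvoid≡count n = begin
      countEqAvoid n (suc d) a
    ≡⟨ length-filterᵇ avoids (allPairs (allVecs n n) (allVecs (suc d) n)) ⟩
      sum (map (𝟙 ∘ avoids) (allPairs (allVecs n n) (allVecs (suc d) n)))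
    ≡⟨ sum-map-concatMap (𝟙 ∘ avoids) (λ xs → map (xs ,_) (allVecs (suc d) n)) (allVecs n n) ⟩
      sum (map (λ xs → sum (map (𝟙 ∘ avoids) (map (xs ,_) (allVecs (suc d) n)))) (allVecs n n))
    ≡⟨ sum-map-cong (allVecs n n) (λ xs → trans (cong sum (sym (map-∘ (allVecs (suc d) n))))
         (sum-map-cong (allVecs (suc d) n) (λ ys →
           cong (λ t → 𝟙 (isSetPartition xs ∧ t)) (not-eqContains≡colourInOneBlock a xs ys)))) ⟩
      count n n 0 nothing
    ∎
    where
    avoids : Colored n (suc d) → Bool
    avoids p = isSetPartition (proj₁ p) ∧ not (eqContains a p)

theorem2p3 : (c n : ℕ) → 1 ≤ c → 1 ≤ n → (a : Fin c) →
    countEqAvoid n c a ≡ rhs n c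
theorem2p3 (suc d) n _ _ a = begin
  countEqAvoid n (suc d) a  ≡⟨ countEqAvoid≡count d a n ⟩
  count d a n n 0 nothing   ≡⟨ count-free d a n n 0 ≤-refl ⟩
  freeExt d n 0             ≡⟨ rhs≡freeExt d n ⟨
  rhs n (suc d)             ∎
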